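{- Let $G=(V,E)$ be a connected graph. If there exists a subset $A\subset V$ with $\emptyset\ne A\ne V$ such that $$|vol(A)-vol(V\setminus A)|\le\frac{vol(V)}{\sqrt{cut(A,V\setminus A)+1}},$$ then $Mcut(G)=\min\{Mcut_j(G): j=1,2,\dots,cut(A,V\setminus A)\}$.
   Context: For a graph with vertex degrees $d_v$: $vol(S)=\sum_{v\in S}d_v$; $cut(S,T)$ is the number of edges between disjoint $S,T$; $Ncut(S,T)=cut(S,T)(1/vol(S)+1/vol(T))$; $Mcut_j(G)=\min\{Ncut(B,V\setminus B):\emptyset\ne B\subsetneq V,\ cut(B,V\setminus B)=j\}$ (with the convention $\min\emptyset=+\infty$); $Mcut(G)=\min_{j\ge1}Mcut_j(G)$. -}

module Defs where

open import Data.Nat using (ℕ; zero; suc; _+_; _*_; _≤_; ∣_-_∣)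
open import Data.Bool using (Bool; true; false; if_then_else_; _∧_; _∨_; not)
open import Data.Fin using (Fin)
open import Data.Nat.ListAction using (sum)
open import Data.List using (List; []; _∷_; map; allFin; filter; foldr; _++_; upTo)
open import Data.Vec using (Vec; lookup; []; _∷_)
open import Data.Fin.Subset using (Subset; ⊤; ∁)
open import Data.Maybe using (Maybe; just; nothing)
open import Data.Integer using (+_)
open import Data.Rational using (ℚ; _/_; _⊓_) renaming (_*_ to _*ℚ_; _+_ to _+ℚ_; 0ℚ to zeroℚ)
open import Relation.Binary.PropositionalEquality using (_≡_)
open import Relation.Nullary using (Dec; does)
open import Data.Nat using (_≟_)

record Graph (n : ℕ) : Set where
  field
    adj    : Fin n → Fin n → Bool
    sym    : ∀ u v → adj u v ≡ adj v u
    irrefl : ∀ v → adj v v ≡ false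
open Graph public

Σᵥ : ∀ {n} → (Fin n → ℕ) → ℕ
Σᵥ {n} f = sum (map f (allFin n))

χ : Bool → ℕ
χ b = if b then 1 else 0

deg : ∀ {n} → Graph n → Fin n → ℕ
deg G v = Σᵥ (λ u → χ (adj G v u))

vol : ∀ {n} → Graph n → Subset n → ℕ
vol G S = Σᵥ (λ v → if lookup S v then deg G v else 0)

cut : ∀ {n} → Graph n → Subset n → Subset n → ℕ
cut G S T = Σᵥ (λ u → Σᵥ (λ v → χ (lookup S u ∧ lookup T v ∧ adj G u v)))

-- p / q as a rational; the value for q = 0 is a junk value that is never
-- used below (Ncut is only evaluated when cut ≥ 1, hence both volumes ≥ 1).
frac : ℕ → ℕ → ℚ
frac p zero    = zeroℚ
frac p (suc q) = (+ p) / suc q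

Ncut : ∀ {n} → Graph n → Subset n → Subset n → ℚ
Ncut G S T = (frac (cut G S T) 1) *ℚ (frac 1 (vol G S) +ℚ frac 1 (vol G T))

allSubsets : (n : ℕ) → List (Subset n)
allSubsets zero    = [] ∷ []
allSubsets (suc n) = map (true ∷_) (allSubsets n) ++ map (false ∷_) (allSubsets n)

anyV : ∀ {n} → Subset n → Bool
anyV {n} S = foldr _∨_ false (map (lookup S) (allFin n))

-- minimum with +∞ represented by nothing
minE : Maybe ℚ → Maybe ℚ → Maybe ℚ
minE nothing  y        = y
minE (just x) nothing  = just x
minE (just x) (just y) = just (x ⊓ y)

minList : List (Maybe ℚ) → Maybe ℚ
minList = foldr minE nothing

Mcutⱼ : ∀ {n} → Graph n → ℕ → Maybe ℚ
Mcutⱼ {n} G j =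
  minList (map (λ B → if anyV B ∧ anyV (∁ B) ∧ does (cut G B (∁ B) ≟ j)
                        then just (Ncut G B (∁ B)) else nothing)
               (allSubsets n))

MinMcutUpTo : ∀ {n} → Graph n → ℕ → Maybe ℚ
MinMcutUpTo G k = minList (map (λ i → Mcutⱼ G (suc i)) (upTo k))

-- Mcut(G) = min_{j ≥ 1} Mcut_j(G).  Since cut(B,V∖B) ≤ n * n, Mcut_j(G) = +∞
-- for every j > n * n, so the minimum over j ≥ 1 equals the minimum over
-- j = 1, …, n * n.
Mcut : ∀ {n} → Graph n → Maybe ℚ
Mcut {n} G = MinMcutUpTo G (n * n)

data Reach {n} (G : Graph n) : Fin n → Fin n → Set where
  here : ∀ {v} → Reach G v v
  step : ∀ {u w v} → adj G u w ≡ true → Reach G w v → Reach G u v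

Connected : ∀ {n} → Graph n → Set
Connected {n} G = ∀ (u v : Fin n) → Reach G u v

module Submission where

-- Write c = cut(A,V∖A), a = vol(A), b = vol(V∖A), V = a + b.
-- Since (a + b)² = 4ab + (a − b)², the hypothesis (a − b)²(c + 1) ≤ V²
-- gives c·(a − b)² ≤ 4ab and hence c·V² ≤ 4(c + 1)·ab.  For any other
-- bipartition B with volumes x + y = V we have 4xy ≤ V², so
-- c·xy ≤ (c + 1)·ab ≤ j·ab whenever j = cut(B,V∖B) > c; multiplying by V
-- this says Ncut(A) = cV/(ab) ≤ jV/(xy) = Ncut(B).  Thus every Mcut_j with
-- j > c is bounded below by Ncut(A), which in turn bounds Mcut_c from above,
-- so extending the minimum over j = 1, …, c to j = 1, …, n² changes nothing.
-- Connectivity is used only to guarantee c ≥ 1 (an edge leaves A), which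
-- makes all volumes occurring in the argument positive.

open import Defs hiding (sym)
open import Data.Nat using (ℕ; _*_; _+_; _≤_; ∣_-_∣)
open import Data.Fin.Subset using (Subset; ⊤; ∁; Nonempty)
open import Relation.Binary.PropositionalEquality using (_≡_)

open import Data.Nat using (suc; zero; s≤s; z≤n; _<_)
open import Data.Nat.Properties
open import Data.Nat.Tactic.RingSolver using (solve-∀)
open import Data.Nat.ListAction using (sum)
open import Data.Sum using (inj₁; inj₂)
open import Data.Fin using (Fin)
open import Data.Bool using (Bool; true; false; _∧_; _∨_; not; if_then_else_)
open import Data.Bool.Properties using (∧-conicalˡ; ∧-conicalʳ; ∨-zeroʳ)
open import Data.List using ([]; _∷_; map; allFin; foldr; _++_; upTo; length; [_])
open import Data.List.Properties using (length-tabulate; map-++; map-cong; upTo-∷ʳ)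
open import Data.List.Membership.Propositional using (_∈_)
open import Data.List.Membership.Propositional.Properties
  using (∈-allFin; ∈-map⁺; ∈-++⁺ˡ; ∈-++⁺ʳ; ∈-upTo⁺)
open import Data.List.Relation.Unary.Any using (here; there)
open import Data.Product using (∃; ∃₂; _×_; _,_)
open import Data.Maybe using (Maybe; just; nothing)
open import Data.Vec using (lookup; _∷_; [])
open import Data.Vec.Properties using (lookup-replicate; lookup-map; []=⇒lookup)
open import Data.Unit using () renaming (⊤ to Unit; tt to unit)
open import Data.Empty using (⊥)
open import Relation.Nullary using (Dec; does; yes)
open import Relation.Nullary.Decidable using (dec-true)
open import Relation.Binary.PropositionalEquality
  using (refl; sym; trans; cong; cong₂; subst; subst₂; module ≡-Reasoning)
open import Data.Integer as ℤ using (+_)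
import Data.Integer.Properties as ℤP
open import Data.Rational as Q using (ℚ; toℚᵘ) renaming (_*_ to _*ℚ_; _+_ to _+ℚ_)
import Data.Rational.Properties as QP
import Data.Rational.Unnormalised as U
open U using (ℚᵘ; mkℚᵘ; ↥_; ↧_)
import Data.Rational.Unnormalised.Properties as UP

square-of-sum-≤ : ∀ {a b} → a ≤ b → (a + b) * (a + b) ≡ 4 * (a * b) + ∣ a - b ∣ * ∣ a - b ∣
square-of-sum-≤ {a} a≤b with m≤n⇒∃[o]m+o≡n a≤b
... | e , refl = begin
  (a + (a + e)) * (a + (a + e))                      ≡⟨ expand a e ⟩
  4 * (a * (a + e)) + e * e                          ≡⟨ cong (λ d → 4 * (a * (a + e)) + d * d) (∣m-m+n∣≡n a e) ⟨
  4 * (a * (a + e)) + ∣ a - a + e ∣ * ∣ a - a + e ∣  ∎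
  where
  open ≡-Reasoning
  expand : ∀ a e → (a + (a + e)) * (a + (a + e)) ≡ 4 * (a * (a + e)) + e * e
  expand = solve-∀

square-of-sum : ∀ a b → (a + b) * (a + b) ≡ 4 * (a * b) + ∣ a - b ∣ * ∣ a - b ∣
square-of-sum a b with ≤-total a b
... | inj₁ a≤b = square-of-sum-≤ a≤b
... | inj₂ b≤a = begin
  (a + b) * (a + b)                      ≡⟨ cong₂ _*_ (+-comm a b) (+-comm a b) ⟩
  (b + a) * (b + a)                      ≡⟨ square-of-sum-≤ b≤a ⟩
  4 * (b * a) + ∣ b - a ∣ * ∣ b - a ∣    ≡⟨ cong₂ (λ p d → 4 * p + d * d) (*-comm b a) (∣-∣-comm b a) ⟩
  4 * (a * b) + ∣ a - b ∣ * ∣ a - b ∣    ∎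
  where open ≡-Reasoning

four-product-≤-square : ∀ x y → 4 * (x * y) ≤ (x + y) * (x + y)
four-product-≤-square x y = subst (4 * (x * y) ≤_) (sym (square-of-sum x y)) (m≤m+n _ _)

balanced-product-bound : ∀ {a b x y c V} → a + b ≡ V → x + y ≡ V →
  ∣ a - b ∣ * ∣ a - b ∣ * (c + 1) ≤ V * V → c * (x * y) ≤ (c + 1) * (a * b)
balanced-product-bound {a} {b} {x} {y} {c} {V} refl x+y≡V balanced = *-cancelˡ-≤ 4 (begin
  4 * (c * (x * y))         ≡⟨ swap4 c (x * y) ⟩
  c * (4 * (x * y))         ≤⟨ *-monoʳ-≤ c (subst (λ s → 4 * (x * y) ≤ s * s) x+y≡V (four-product-≤-square x y)) ⟩
  c * (V * V)               ≡⟨ cong (c *_) (square-of-sum a b) ⟩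
  c * (4 * (a * b) + d²)    ≡⟨ *-distribˡ-+ c (4 * (a * b)) d² ⟩
  c * (4 * (a * b)) + c * d² ≤⟨ +-monoʳ-≤ (c * (4 * (a * b))) c·d²≤4ab ⟩
  c * (4 * (a * b)) + 4 * (a * b) ≡⟨ collect c (a * b) ⟩
  4 * ((c + 1) * (a * b))   ∎)
  where
  open ≤-Reasoning
  d² : ℕ
  d² = ∣ a - b ∣ * ∣ a - b ∣
  swap4 : ∀ c p → 4 * (c * p) ≡ c * (4 * p)
  swap4 = solve-∀
  collect : ∀ c p → c * (4 * p) + 4 * p ≡ 4 * ((c + 1) * p)
  collect = solve-∀
  -- (c + 1)d² ≤ V² = 4ab + d², so c·d² ≤ 4ab.
  c·d²≤4ab : c * d² ≤ 4 * (a * b)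
  c·d²≤4ab = +-cancelʳ-≤ d² (c * d²) (4 * (a * b)) (begin
    c * d² + d²        ≡⟨ factor-out c d² ⟩
    d² * (c + 1)       ≤⟨ balanced ⟩
    V * V              ≡⟨ square-of-sum a b ⟩
    4 * (a * b) + d²   ∎)
    where
    factor-out : ∀ c e → c * e + e ≡ e * (c + 1)
    factor-out = solve-∀

ncutValue : ℕ → ℕ → ℕ → ℚ
ncutValue c x y = frac c 1 *ℚ (frac 1 x +ℚ frac 1 y)

-- For positive volumes the same value as an unnormalised fraction:
-- c·((1 + y) + (1 + x)) / ((1 + x)(1 + y)).
ncutᵘ : ℕ → ℕ → ℕ → ℚᵘ
ncutᵘ c x y = mkℚᵘ (+ c) 0 U.* (mkℚᵘ (+ 1) x U.+ mkℚᵘ (+ 1) y)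

ncutValue≃ncutᵘ : ∀ c x y → toℚᵘ (ncutValue c (suc x) (suc y)) U.≃ ncutᵘ c x y
ncutValue≃ncutᵘ c x y = UP.≃-trans (QP.toℚᵘ-homo-* (frac c 1) _)
  (UP.*-cong (QP.toℚᵘ-fromℚᵘ (mkℚᵘ (+ c) 0))
     (UP.≃-trans (QP.toℚᵘ-homo-+ (frac 1 (suc x)) (frac 1 (suc y)))
        (UP.+-cong (QP.toℚᵘ-fromℚᵘ (mkℚᵘ (+ 1) x)) (QP.toℚᵘ-fromℚᵘ (mkℚᵘ (+ 1) y)))))

ncutᵘ-numerator : ∀ c x y → ↥ ncutᵘ c x y ≡ + (c * (suc x + suc y))
ncutᵘ-numerator c x y = begin
  + c ℤ.* (+ 1 ℤ.* + suc y ℤ.+ + 1 ℤ.* + suc x) ≡⟨ cong (+ c ℤ.*_) (cong₂ ℤ._+_ (ℤP.*-identityˡ (+ suc y)) (ℤP.*-identityˡ (+ suc x))) ⟩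
  + c ℤ.* (+ (suc y + suc x))                   ≡⟨ ℤP.pos-* c (suc y + suc x) ⟨
  + (c * (suc y + suc x))                       ≡⟨ cong (λ s → + (c * s)) (+-comm (suc y) (suc x)) ⟩
  + (c * (suc x + suc y))                       ∎
  where open ≡-Reasoning

ncutᵘ-denominator : ∀ c x y → ↧ ncutᵘ c x y ≡ + (suc x * suc y)
ncutᵘ-denominator c x y = cong +_ (*-identityˡ (suc x * suc y))

ncutValue-≤ : ∀ c j a b x y →
  c * (suc a + suc b) * (suc x * suc y) ≤ j * (suc x + suc y) * (suc a * suc b) →
  ncutValue c (suc a) (suc b) Q.≤ ncutValue j (suc x) (suc y)
ncutValue-≤ c j a b x y cross = QP.toℚᵘ-cancel-≤
  (UP.≤-respˡ-≃ (UP.≃-sym (ncutValue≃ncutᵘ c a b))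
    (UP.≤-respʳ-≃ (UP.≃-sym (ncutValue≃ncutᵘ j x y))
      (U.*≤* (subst₂ ℤ._≤_ (cross-term c a b j x y) (cross-term j x y c a b) (ℤ.+≤+ cross)))))
  where
  cross-term : ∀ c a b j x y → + (c * (suc a + suc b) * (suc x * suc y)) ≡ ↥ ncutᵘ c a b ℤ.* ↧ ncutᵘ j x y
  cross-term c a b j x y = trans (ℤP.pos-* (c * (suc a + suc b)) (suc x * suc y))
    (cong₂ ℤ._*_ (sym (ncutᵘ-numerator c a b)) (sym (ncutᵘ-denominator j x y)))

balanced-ncut-≤ : ∀ {a b x y c j V} → 1 ≤ a → 1 ≤ b → 1 ≤ x → 1 ≤ y →
  a + b ≡ V → x + y ≡ V → ∣ a - b ∣ * ∣ a - b ∣ * (c + 1) ≤ V * V → c < j →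
  ncutValue c a b Q.≤ ncutValue j x y
balanced-ncut-≤ {suc a} {suc b} {suc x} {suc y} {c} {j} {V} (s≤s z≤n) (s≤s z≤n) (s≤s z≤n) (s≤s z≤n)
                a+b≡V x+y≡V balanced c<j =
  ncutValue-≤ c j a b x y (begin
    c * (suc a + suc b) * (suc x * suc y)  ≡⟨ reorder c (suc a + suc b) (suc x * suc y) ⟩
    (suc a + suc b) * (c * (suc x * suc y)) ≡⟨ cong (λ s → s * (c * (suc x * suc y))) (trans a+b≡V (sym x+y≡V)) ⟩
    (suc x + suc y) * (c * (suc x * suc y)) ≤⟨ *-monoʳ-≤ (suc x + suc y) product-bound ⟩
    (suc x + suc y) * (j * (suc a * suc b)) ≡⟨ reorder j (suc x + suc y) (suc a * suc b) ⟨
    j * (suc x + suc y) * (suc a * suc b)  ∎)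
  where
  open ≤-Reasoning
  reorder : ∀ c s p → c * s * p ≡ s * (c * p)
  reorder = solve-∀
  product-bound : c * (suc x * suc y) ≤ j * (suc a * suc b)
  product-bound = ≤-trans (balanced-product-bound {suc a} {suc b} {suc x} {suc y} {c} a+b≡V x+y≡V balanced)
                          (*-monoˡ-≤ (suc a * suc b) (subst (_≤ j) (+-comm 1 c) c<j))

sum-map-member-≤ : ∀ {A : Set} (f : A → ℕ) {x l} → x ∈ l → f x ≤ sum (map f l)
sum-map-member-≤ f (here refl) = m≤m+n _ _
sum-map-member-≤ f {l = y ∷ l} (there x∈l) = ≤-trans (sum-map-member-≤ f x∈l) (m≤n+m _ (f y))

sum-map-positive : ∀ {A : Set} (f : A → ℕ) l → 1 ≤ sum (map f l) → ∃ λ x → x ∈ l × 1 ≤ f x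
sum-map-positive f (y ∷ l) positive with f y in fy
... | suc _ = y , here refl , subst (1 ≤_) (sym fy) (s≤s z≤n)
... | zero with sum-map-positive f l positive
...   | x , x∈l , fx = x , there x∈l , fx

sum-map-≤-length : ∀ {A : Set} (f : A → ℕ) k l → (∀ x → f x ≤ k) → sum (map f l) ≤ length l * k
sum-map-≤-length f k []      bound = z≤n
sum-map-≤-length f k (y ∷ l) bound = +-mono-≤ (bound y) (sum-map-≤-length f k l bound)

sum-map-+ : ∀ {A : Set} (f g : A → ℕ) l → sum (map (λ x → f x + g x) l) ≡ sum (map f l) + sum (map g l)
sum-map-+ f g []      = refl
sum-map-+ f g (y ∷ l) = trans (cong (_+_ (f y + g y)) (sum-map-+ f g l)) (interchange (f y) (g y) _ _)
  where
  interchange : ∀ a b s t → (a + b) + (s + t) ≡ (a + s) + (b + t)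
  interchange = solve-∀

lookup-∁ : ∀ {n} (S : Subset n) v → lookup (∁ S) v ≡ not (lookup S v)
lookup-∁ S v = lookup-map v not S

vol-split : ∀ {n} (G : Graph n) S → vol G ⊤ ≡ vol G S + vol G (∁ S)
vol-split {n} G S = trans (cong sum (map-cong pointwise (allFin n))) (sum-map-+ (side S) (side (∁ S)) (allFin n))
  where
  side : Subset n → Fin n → ℕ
  side T v = if lookup T v then deg G v else 0
  pointwise : ∀ v → side ⊤ v ≡ side S v + side (∁ S) v
  pointwise v rewrite lookup-replicate v true | lookup-∁ S v with lookup S v
  ... | true  = sym (+-identityʳ (deg G v))
  ... | false = refl

cutEntry : ∀ {n} → Graph n → Subset n → Subset n → Fin n → Fin n → ℕ
cutEntry G S T u v = χ (lookup S u ∧ lookup T v ∧ adj G u v)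

CrossingEdge : ∀ {n} → Graph n → Subset n → Subset n → Set
CrossingEdge G S T = ∃₂ λ u v → lookup S u ≡ true × lookup T v ≡ true × adj G u v ≡ true

crossingEdge⇒cut-positive : ∀ {n} (G : Graph n) S T → CrossingEdge G S T → 1 ≤ cut G S T
crossingEdge⇒cut-positive G S T (u , v , u∈S , v∈T , uv) = begin
  1                          ≡⟨ sym entry ⟩
  cutEntry G S T u v         ≤⟨ sum-map-member-≤ (cutEntry G S T u) (∈-allFin v) ⟩
  Σᵥ (cutEntry G S T u)      ≤⟨ sum-map-member-≤ (λ w → Σᵥ (cutEntry G S T w)) (∈-allFin u) ⟩
  cut G S T                  ∎
  where
  open ≤-Reasoning
  entry : cutEntry G S T u v ≡ 1
  entry rewrite u∈S | v∈T | uv = refl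

cut-positive⇒crossingEdge : ∀ {n} (G : Graph n) S T → 1 ≤ cut G S T → CrossingEdge G S T
cut-positive⇒crossingEdge {n} G S T positive
  with sum-map-positive (λ u → Σᵥ (cutEntry G S T u)) (allFin n) positive
... | u , _ , row-positive with sum-map-positive (cutEntry G S T u) (allFin n) row-positive
... | v , _ , entry-positive =
  u , v , ∧-conicalˡ (lookup S u) _ uvEdge , ∧-conicalˡ (lookup T v) _ rest , ∧-conicalʳ (lookup T v) _ rest
  where
  χ-positive : ∀ b → 1 ≤ χ b → b ≡ true
  χ-positive true _ = refl
  uvEdge : lookup S u ∧ lookup T v ∧ adj G u v ≡ true
  uvEdge = χ-positive _ entry-positive
  rest : lookup T v ∧ adj G u v ≡ true
  rest = ∧-conicalʳ (lookup S u) _ uvEdge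

deg-positive : ∀ {n} (G : Graph n) u v → adj G u v ≡ true → 1 ≤ deg G u
deg-positive G u v uv = subst (_≤ deg G u) (cong χ uv) (sum-map-member-≤ (λ w → χ (adj G u w)) (∈-allFin v))

deg-≤-vol : ∀ {n} (G : Graph n) S u → lookup S u ≡ true → deg G u ≤ vol G S
deg-≤-vol G S u u∈S = subst (_≤ vol G S) (cong (λ b → if b then deg G u else 0) u∈S)
  (sum-map-member-≤ (λ v → if lookup S v then deg G v else 0) (∈-allFin u))

cut-positive⇒vol-positive : ∀ {n} (G : Graph n) S T → 1 ≤ cut G S T → 1 ≤ vol G S × 1 ≤ vol G T
cut-positive⇒vol-positive G S T positive with cut-positive⇒crossingEdge G S T positive
... | u , v , u∈S , v∈T , uv =
  ≤-trans (deg-positive G u v uv) (deg-≤-vol G S u u∈S) ,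
  ≤-trans (deg-positive G v u (trans (Graph.sym G v u) uv)) (deg-≤-vol G T v v∈T)

walk-leaves : ∀ {n} (G : Graph n) A {u v} → Reach G u v →
  lookup A u ≡ true → lookup (∁ A) v ≡ true → CrossingEdge G A (∁ A)
walk-leaves G A {u} here u∈A u∉A with trans (sym u∉A) (trans (lookup-∁ A u) (cong not u∈A))
... | ()
walk-leaves G A (step {w = w} uw walk) u∈A v∉A with lookup A w in w∈A
... | true  = walk-leaves G A walk w∈A v∉A
... | false = _ , w , u∈A , trans (lookup-∁ A w) (cong not w∈A) , uw

connected⇒crossingEdge : ∀ {n} (G : Graph n) → Connected G → (A : Subset n) →
  Nonempty A → Nonempty (∁ A) → CrossingEdge G A (∁ A)
connected⇒crossingEdge G connected A (u , u∈A) (v , v∉A) =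
  walk-leaves G A (connected u v) ([]=⇒lookup u∈A) ([]=⇒lookup v∉A)

cut-≤-n² : ∀ {n} (G : Graph n) S T → cut G S T ≤ n * n
cut-≤-n² {n} G S T = subst (cut G S T ≤_) (cong (_* n) (length-allFin n))
  (sum-map-≤-length (λ u → Σᵥ (cutEntry G S T u)) n (allFin n) row-≤-n)
  where
  length-allFin : ∀ n → length (allFin n) ≡ n
  length-allFin n = length-tabulate {n = n} (λ i → i)
  χ-≤-1 : ∀ b → χ b ≤ 1
  χ-≤-1 true  = s≤s z≤n
  χ-≤-1 false = z≤n
  row-≤-n : ∀ u → Σᵥ (cutEntry G S T u) ≤ n
  row-≤-n u = subst (Σᵥ (cutEntry G S T u) ≤_) (trans (cong (_* 1) (length-allFin n)) (*-identityʳ n))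
    (sum-map-≤-length (cutEntry G S T u) 1 (allFin n) (λ v → χ-≤-1 _))

balanced-cut-minimal : ∀ {n} (G : Graph n) (A B : Subset n) → 1 ≤ cut G A (∁ A) →
  ∣ vol G A - vol G (∁ A) ∣ * ∣ vol G A - vol G (∁ A) ∣ * (cut G A (∁ A) + 1) ≤ vol G ⊤ * vol G ⊤ →
  cut G A (∁ A) < cut G B (∁ B) → Ncut G A (∁ A) Q.≤ Ncut G B (∁ B)
balanced-cut-minimal G A B cutA-positive balanced larger
  with cut-positive⇒vol-positive G A (∁ A) cutA-positive
     | cut-positive⇒vol-positive G B (∁ B) (≤-trans (s≤s z≤n) larger)
... | volA , volĀ | volB , volB̄ =
  balanced-ncut-≤ volA volĀ volB volB̄ (sym (vol-split G A)) (sym (vol-split G B)) balanced larger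

_≼_ : Maybe ℚ → Maybe ℚ → Set
_      ≼ nothing = Unit
nothing ≼ just _ = ⊥
just p ≼ just q  = p Q.≤ q

≼-trans : ∀ x y z → x ≼ y → y ≼ z → x ≼ z
≼-trans x        y        nothing  _   _   = unit
≼-trans (just p) (just q) (just r) p≤q q≤r = QP.≤-trans p≤q q≤r

minE-≼ˡ : ∀ x y → minE x y ≼ x
minE-≼ˡ nothing  y        = unit
minE-≼ˡ (just p) nothing  = QP.≤-refl
minE-≼ˡ (just p) (just q) = QP.p⊓q≤p p q

minE-≼ʳ : ∀ x y → minE x y ≼ y
minE-≼ʳ x        nothing  = unit
minE-≼ʳ nothing  (just q) = QP.≤-refl
minE-≼ʳ (just p) (just q) = QP.p⊓q≤q p q

minE-greatest : ∀ x y z → z ≼ x → z ≼ y → z ≼ minE x y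
minE-greatest nothing  y        z        _    z≼y  = z≼y
minE-greatest (just p) nothing  z        z≼x  _    = z≼x
minE-greatest (just p) (just q) nothing  ()   _
minE-greatest (just p) (just q) (just r) r≤p  r≤q  = QP.⊓-glb r≤p r≤q

minE-absorb : ∀ x y → x ≼ y → minE x y ≡ x
minE-absorb nothing  nothing  _   = refl
minE-absorb (just p) nothing  _   = refl
minE-absorb (just p) (just q) p≤q = cong just (QP.p≤q⇒p⊓q≡p p≤q)

minE-assoc : ∀ x y z → minE (minE x y) z ≡ minE x (minE y z)
minE-assoc nothing  y        z        = refl
minE-assoc (just p) nothing  z        = refl
minE-assoc (just p) (just q) nothing  = refl
minE-assoc (just p) (just q) (just r) = cong just (QP.⊓-assoc p q r)

minList-≼-member : ∀ {A : Set} (g : A → Maybe ℚ) {x l} → x ∈ l → minList (map g l) ≼ g x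
minList-≼-member g {l = y ∷ l} (here refl) = minE-≼ˡ (g y) (minList (map g l))
minList-≼-member g {l = y ∷ l} (there x∈l) =
  ≼-trans _ _ _ (minE-≼ʳ (g y) (minList (map g l))) (minList-≼-member g x∈l)

minList-greatest : ∀ {A : Set} (g : A → Maybe ℚ) z l → (∀ x → z ≼ g x) → z ≼ minList (map g l)
minList-greatest g z []      below = unit
minList-greatest g z (y ∷ l) below =
  minE-greatest (g y) (minList (map g l)) z (below y) (minList-greatest g z l below)

minList-++ : ∀ xs ys → minList (xs ++ ys) ≡ minE (minList xs) (minList ys)
minList-++ []       ys = refl
minList-++ (x ∷ xs) ys = trans (cong (minE x) (minList-++ xs ys)) (sym (minE-assoc x (minList xs) (minList ys)))

minList-upTo-suc : ∀ (F : ℕ → Maybe ℚ) k →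
  minList (map F (upTo (suc k))) ≡ minE (minList (map F (upTo k))) (F k)
minList-upTo-suc F k = begin
  minList (map F (upTo (suc k)))                   ≡⟨ cong (λ l → minList (map F l)) (upTo-∷ʳ k) ⟨
  minList (map F (upTo k ++ [ k ]))                ≡⟨ cong minList (map-++ F (upTo k) [ k ]) ⟩
  minList (map F (upTo k) ++ [ F k ])              ≡⟨ minList-++ (map F (upTo k)) [ F k ] ⟩
  minE (minList (map F (upTo k))) (minE (F k) nothing) ≡⟨ cong (minE _) (minE-absorb (F k) nothing unit) ⟩
  minE (minList (map F (upTo k))) (F k)            ∎
  where open ≡-Reasoning

minList-upTo-stable : ∀ (F : ℕ → Maybe ℚ) k →
  (∀ i → k ≤ i → minList (map F (upTo k)) ≼ F i) →
  ∀ {m} → k ≤ m → minList (map F (upTo m)) ≡ minList (map F (upTo k))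
minList-upTo-stable F k above k≤m with m≤n⇒∃[o]m+o≡n k≤m
... | d , refl = extend d
  where
  extend : ∀ d → minList (map F (upTo (k + d))) ≡ minList (map F (upTo k))
  extend zero    = cong (λ m → minList (map F (upTo m))) (+-identityʳ k)
  extend (suc d) = begin
    minList (map F (upTo (k + suc d)))                  ≡⟨ cong (λ m → minList (map F (upTo m))) (+-suc k d) ⟩
    minList (map F (upTo (suc (k + d))))                ≡⟨ minList-upTo-suc F (k + d) ⟩
    minE (minList (map F (upTo (k + d)))) (F (k + d))  ≡⟨ cong (λ z → minE z (F (k + d))) (extend d) ⟩
    minE (minList (map F (upTo k))) (F (k + d))        ≡⟨ minE-absorb _ (F (k + d)) (above (k + d) (m≤m+n k d)) ⟩
    minList (map F (upTo k))                           ∎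
    where open ≡-Reasoning

allSubsets-complete : ∀ {n} (S : Subset n) → S ∈ allSubsets n
allSubsets-complete []          = here refl
allSubsets-complete (true ∷ S)  = ∈-++⁺ˡ (∈-map⁺ (true ∷_) (allSubsets-complete S))
allSubsets-complete (false ∷ S) = ∈-++⁺ʳ (map (true ∷_) (allSubsets _)) (∈-map⁺ (false ∷_) (allSubsets-complete S))

or-member : ∀ {A : Set} (g : A → Bool) {x l} → x ∈ l → g x ≡ true → foldr _∨_ false (map g l) ≡ true
or-member g (here refl) gx rewrite gx = refl
or-member g {l = y ∷ l} (there x∈l) gx rewrite or-member g x∈l gx = ∨-zeroʳ (g y)

anyV-nonempty : ∀ {n} (S : Subset n) → Nonempty S → anyV S ≡ true
anyV-nonempty S (x , x∈S) = or-member (lookup S) (∈-allFin x) ([]=⇒lookup x∈S)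

does-true : ∀ {P : Set} (d : Dec P) → does d ≡ true → P
does-true (yes p) _ = p

candidate : ∀ {n} → Graph n → ℕ → Subset n → Maybe ℚ
candidate G j B = if anyV B ∧ anyV (∁ B) ∧ does (cut G B (∁ B) ≟ j) then just (Ncut G B (∁ B)) else nothing

Mcutⱼ-≼-Ncut : ∀ {n} (G : Graph n) B → Nonempty B → Nonempty (∁ B) →
  Mcutⱼ G (cut G B (∁ B)) ≼ just (Ncut G B (∁ B))
Mcutⱼ-≼-Ncut G B nonempty co-nonempty =
  subst (Mcutⱼ G (cut G B (∁ B)) ≼_) B-is-candidate
    (minList-≼-member (candidate G (cut G B (∁ B))) (allSubsets-complete B))
  where
  B-is-candidate : candidate G (cut G B (∁ B)) B ≡ just (Ncut G B (∁ B))
  B-is-candidate rewrite anyV-nonempty B nonempty | anyV-nonempty (∁ B) co-nonempty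
                       | dec-true (cut G B (∁ B) ≟ cut G B (∁ B)) refl = refl

Mcutⱼ-lower-bound : ∀ {n} (G : Graph n) j m →
  (∀ B → cut G B (∁ B) ≡ j → m Q.≤ Ncut G B (∁ B)) → just m ≼ Mcutⱼ G j
Mcutⱼ-lower-bound {n} G j m bound = minList-greatest (candidate G j) (just m) (allSubsets n) candidate-above
  where
  just-≼-if : ∀ b q → (b ≡ true → m Q.≤ q) → just m ≼ (if b then just q else nothing)
  just-≼-if true  q m≤q = m≤q refl
  just-≼-if false q _   = unit
  candidate-above : ∀ B → just m ≼ candidate G j B
  candidate-above B = just-≼-if _ _ λ selected →
    bound B (does-true (cut G B (∁ B) ≟ j) (∧-conicalʳ _ _ (∧-conicalʳ (anyV B) _ selected)))

MinMcutUpTo-≼-Mcutⱼ : ∀ {n} (G : Graph n) {j k} → 1 ≤ j → j ≤ k → MinMcutUpTo G k ≼ Mcutⱼ G j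
MinMcutUpTo-≼-Mcutⱼ G {suc i} (s≤s z≤n) j≤k = minList-≼-member (λ i → Mcutⱼ G (suc i)) (∈-upTo⁺ j≤k)

lemma9 : ∀ (n : ℕ) (G : Graph n) → Connected G →
         (A : Subset n) → Nonempty A → Nonempty (∁ A) →
         ∣ vol G A - vol G (∁ A) ∣ * ∣ vol G A - vol G (∁ A) ∣ * (cut G A (∁ A) + 1)
           ≤ vol G ⊤ * vol G ⊤ →
         Mcut G ≡ MinMcutUpTo G (cut G A (∁ A))
lemma9 n G connected A nonempty co-nonempty balanced =
  minList-upTo-stable (λ i → Mcutⱼ G (suc i)) c (λ i c≤i → below-larger (suc i) (s≤s c≤i)) (cut-≤-n² G A (∁ A))
  where
  c : ℕ
  c = cut G A (∁ A)
  c-positive : 1 ≤ c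
  c-positive = crossingEdge⇒cut-positive G A (∁ A) (connected⇒crossingEdge G connected A nonempty co-nonempty)
  NcutA : Maybe ℚ
  NcutA = just (Ncut G A (∁ A))
  A-below-larger : ∀ j → c < j → NcutA ≼ Mcutⱼ G j
  A-below-larger j c<j = Mcutⱼ-lower-bound G j (Ncut G A (∁ A)) λ B cutB≡j →
    balanced-cut-minimal G A B c-positive balanced (subst (c <_) (sym cutB≡j) c<j)
  below-larger : ∀ j → c < j → MinMcutUpTo G c ≼ Mcutⱼ G j
  below-larger j c<j = ≼-trans _ NcutA _
    (≼-trans _ (Mcutⱼ G c) _ (MinMcutUpTo-≼-Mcutⱼ G c-positive ≤-refl) (Mcutⱼ-≼-Ncut G A nonempty co-nonempty))
    (A-below-larger j c<j)
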